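{- Let $G=(V,E)$ be a graph, let $R,t,M$ be integers with $1\le M\le R$, and let $x,y\in V$. Let $\mathbf M$ be the random walk transition matrix of $G$. Let $Z_b$ ($1\le b\le R/M$) be the batch estimate computed in $\textsc{EstRWDot}(G,R,t,M,x,y)$. Then $$\mathbb E[Z_b]=\langle\mathbf M^t\mathbb 1_x,\mathbf M^t\mathbb 1_y\rangle,$$ $$\mathrm{Var}[Z_b]\le\frac1{M^2}\|\mathbf M^t\mathbb 1_x\|_2\|\mathbf M^t\mathbb 1_y\|_2+\frac1M\left(\|\mathbf M^t\mathbb 1_x\|_2\|\mathbf M^t\mathbb 1_y\|_2^2+\|\mathbf M^t\mathbb 1_x\|_2^2\|\mathbf M^t\mathbb 1_y\|_2\right).$$
   Context: $\mathbf M$ is the transition matrix of the random walk used by the algorithm (for $d$-regular $G$, the lazy walk $\mathbf M=\frac12(I+A/d)$, $A$ the adjacency matrix); $\mathbb 1_x$ is the indicator vector of $x$. $\textsc{EstRWDot}(G,R,t,M,x,y)$: for each of $B=R/M$ batches $b$, run $M$ independent random walks of length $t$ from $x$ and $M$ independent ones from $y$ (all independent), let $\hat p_x(i)$ (resp. $\hat p_y(i)$) be the fraction of the walks from $x$ (resp. $y$) in this batch ending at vertex $i$, and set $Z_b=\langle\hat p_x,\hat p_y\rangle$; the output is $Z=\frac1B\sum_{b=1}^BZ_b$. -}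

module Defs where

open import Data.Nat as ℕ using (ℕ; zero; suc)
open import Data.Integer using (+_)
open import Data.Rational using (ℚ; 0ℚ; 1ℚ; _+_; _*_; _/_)
open import Data.Fin using (Fin)
open import Data.Fin.Properties using (_≟_)
open import Data.Bool using (Bool; true; false; if_then_else_)
open import Data.List using (List; []; _∷_; map; foldr; concatMap; allFin)
open import Data.Vec using (Vec; []; _∷_)
open import Relation.Nullary.Decidable using (⌊_⌋)

-- k / m as a rational (m = 0 gives 0; only used with m ≥ 1)
divℕ : ℕ → ℕ → ℚ
divℕ k zero    = 0ℚ
divℕ k (suc m) = + k / suc m

sumℚ : List ℚ → ℚ
sumℚ = foldr _+_ 0ℚ

prodℚ : List ℚ → ℚ
prodℚ = foldr _*_ 1ℚ

Σᵥ : {n : ℕ} → (Fin n → ℚ) → ℚ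
Σᵥ {n} f = sumℚ (map f (allFin n))

vecsOver : {A : Set} → List A → (k : ℕ) → List (Vec A k)
vecsOver xs zero    = [] ∷ []
vecsOver xs (suc k) = concatMap (λ a → map (a ∷_) (vecsOver xs k)) xs

vecToList : {A : Set} {k : ℕ} → Vec A k → List A
vecToList []       = []
vecToList (a ∷ as) = a ∷ vecToList as

δ : {n : ℕ} → Fin n → Fin n → ℚ
δ u v = if ⌊ u ≟ v ⌋ then 1ℚ else 0ℚ

Adjacency : ℕ → Set
Adjacency n = Fin n → Fin n → Bool

degree : {n : ℕ} → Adjacency n → Fin n → ℕ
degree {n} A u = Data.List.length (Data.List.filterᵇ (A u) (allFin n))

-- lazy random walk matrix  𝐌 = ½ (I + A/d);  𝐌 u v = entry in row u, column v
-- (symmetric, = probability of stepping from v to u)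
walkMat : {n : ℕ} → Adjacency n → ℕ → Fin n → Fin n → ℚ
walkMat A d u v =
  divℕ 1 2 * δ u v + (if A u v then divℕ 1 (2 ℕ.* d) else 0ℚ)

Mpow1 : {n : ℕ} → Adjacency n → ℕ → (t : ℕ) → Fin n → Fin n → ℚ
Mpow1 A d zero    x i = δ x i
Mpow1 A d (suc t) x i = Σᵥ (λ j → walkMat A d i j * Mpow1 A d t x j)

inner : {n : ℕ} → (Fin n → ℚ) → (Fin n → ℚ) → ℚ
inner p q = Σᵥ (λ i → p i * q i)

normSq : {n : ℕ} → (Fin n → ℚ) → ℚ
normSq p = inner p p

-- A random walk of length t from s is the sequence of its t subsequent vertices.
Walk : ℕ → ℕ → Set
Walk n t = Vec (Fin n) t

allWalks : (n t : ℕ) → List (Walk n t)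
allWalks n t = vecsOver (allFin n) t

walkProb : {n t : ℕ} → Adjacency n → ℕ → Fin n → Walk n t → ℚ
walkProb A d s []       = 1ℚ
walkProb A d s (v ∷ w)  = walkMat A d v s * walkProb A d v w

endpoint : {n t : ℕ} → Fin n → Walk n t → Fin n
endpoint s []      = s
endpoint s (v ∷ w) = endpoint v w

Batch : ℕ → ℕ → ℕ → Set
Batch n t M = Vec (Walk n t) M

allBatches : (n t M : ℕ) → List (Batch n t M)
allBatches n t M = vecsOver (allWalks n t) M

batchProb : {n t M : ℕ} → Adjacency n → ℕ → Fin n → Batch n t M → ℚ
batchProb A d s ws = prodℚ (map (walkProb A d s) (vecToList ws))

pHat : {n t M : ℕ} → Fin n → Batch n t M → Fin n → ℚ
pHat {M = M} s ws i =
  divℕ (Data.List.length (Data.List.filterᵇ (λ w → ⌊ endpoint s w ≟ i ⌋) (vecToList ws))) M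

Zb : {n t M : ℕ} → Fin n → Fin n → Batch n t M → Batch n t M → ℚ
Zb x y wx wy = inner (pHat x wx) (pHat y wy)

Expect : {n : ℕ} → Adjacency n → ℕ → (t M : ℕ) → Fin n → Fin n
       → (Batch n t M → Batch n t M → ℚ) → ℚ
Expect {n} A d t M x y f =
  sumℚ (map (λ wx → sumℚ (map (λ wy →
      batchProb A d x wx * batchProb A d y wy * f wx wy)
    (allBatches n t M))) (allBatches n t M))

Var : {n : ℕ} → Adjacency n → ℕ → (t M : ℕ) → Fin n → Fin n
    → (Batch n t M → Batch n t M → ℚ) → ℚ
Var A d t M x y f =
  Expect A d t M x y (λ a b → f a b * f a b)
  Data.Rational.- (Expect A d t M x y f * Expect A d t M x y f)

{-# OPTIONS --safe #-}

-- The M walks of a batch started at x are i.i.d. with endpoint distribution p_x = 𝐌^t 𝟙_x,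
-- so with u = 1/M the endpoint frequencies satisfy E[p̂_x(i)] = p_x(i) and
--   E[p̂_x(i) p̂_x(j)] = u δ_ij p_x(i) + (1 - u) p_x(i) p_x(j).
-- The batches from x and y are independent, which gives E[Z_b] = ⟨p_x, p_y⟩ and
--   Var[Z_b] = u² ⟨p_x, p_y⟩ + u (1 - u) (⟨p_x, p_y²⟩ + ⟨p_y, p_x²⟩)
--            + ((1 - u)² - 1) ⟨p_x, p_y⟩².
-- The last term is nonpositive, and Cauchy–Schwarz, together with ‖p²‖₂ ≤ ‖p‖₂², bounds
-- the others.

module Submission where

open import Defs
open import Level using (0ℓ)
open import Function using (_∘_)
open import Data.Nat as ℕ using (ℕ; zero; suc)
open import Data.Nat.Properties as ℕ using ()
import Data.Integer as ℤ
open import Data.Integer.Properties as ℤ using ()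
open import Data.Rational
  using (ℚ; 0ℚ; 1ℚ; _≤_; _+_; _*_; _-_; -_; toℚᵘ; fromℚᵘ; positive; nonNegative; nonPositive)
open import Data.Rational.Properties
open import Data.Rational.Unnormalised as ℚᵘ using (mkℚᵘ; *≡*)
import Data.Rational.Unnormalised.Properties as ℚᵘ
open import Data.Bool using (Bool; true; false; if_then_else_)
open import Data.Fin using (Fin; zero; suc)
open import Data.Fin.Properties using () renaming (_≟_ to _≟ᶠ_)
open import Data.Vec using (Vec; _∷_)
open import Data.List using (List; []; _∷_; map; concatMap; allFin; length; filterᵇ; _++_)
open import Data.List.Properties using (map-tabulate)
open import Relation.Nullary using (yes; no; contradiction)
open import Relation.Nullary.Decidable using (dec⇒maybe; ⌊_⌋)
open import Data.Product using (_×_; _,_)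
open import Data.Sum using (inj₁; inj₂)
open import Relation.Binary.PropositionalEquality
import Tactic.RingSolver.Core.AlmostCommutativeRing as ACR
open import Tactic.RingSolver using (solve-∀)
open import Algebra.Bundles using (CommutativeMonoid)
open import Algebra.Properties.CommutativeSemigroup
  (CommutativeMonoid.commutativeSemigroup *-1-commutativeMonoid)
  using () renaming (interchange to *-interchange; x∙yz≈y∙xz to *-left-comm)
open import Algebra.Properties.CommutativeSemigroup
  (CommutativeMonoid.commutativeSemigroup +-0-commutativeMonoid)
  using () renaming (interchange to +-interchange)

-- Rational arithmetic

ℚ-ring : ACR.AlmostCommutativeRing 0ℓ 0ℓ
ℚ-ring = ACR.fromCommutativeRing +-*-commutativeRing (λ p → dec⇒maybe (0ℚ ≟ p))

fromℚᵘ-homo-+ : ∀ p q → fromℚᵘ (p ℚᵘ.+ q) ≡ fromℚᵘ p + fromℚᵘ q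
fromℚᵘ-homo-+ p q = toℚᵘ-injective (begin-equality
  toℚᵘ (fromℚᵘ (p ℚᵘ.+ q))               ≃⟨ toℚᵘ-fromℚᵘ (p ℚᵘ.+ q) ⟩
  p ℚᵘ.+ q                               ≃⟨ ℚᵘ.+-cong (toℚᵘ-fromℚᵘ p) (toℚᵘ-fromℚᵘ q) ⟨
  toℚᵘ (fromℚᵘ p) ℚᵘ.+ toℚᵘ (fromℚᵘ q)   ≃⟨ toℚᵘ-homo-+ (fromℚᵘ p) (fromℚᵘ q) ⟨
  toℚᵘ (fromℚᵘ p + fromℚᵘ q)              ∎)
  where open ℚᵘ.≤-Reasoning

fromℚᵘ-homo-* : ∀ p q → fromℚᵘ (p ℚᵘ.* q) ≡ fromℚᵘ p * fromℚᵘ q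
fromℚᵘ-homo-* p q = toℚᵘ-injective (begin-equality
  toℚᵘ (fromℚᵘ (p ℚᵘ.* q))               ≃⟨ toℚᵘ-fromℚᵘ (p ℚᵘ.* q) ⟩
  p ℚᵘ.* q                               ≃⟨ ℚᵘ.*-cong (toℚᵘ-fromℚᵘ p) (toℚᵘ-fromℚᵘ q) ⟨
  toℚᵘ (fromℚᵘ p) ℚᵘ.* toℚᵘ (fromℚᵘ q)   ≃⟨ toℚᵘ-homo-* (fromℚᵘ p) (fromℚᵘ q) ⟨
  toℚᵘ (fromℚᵘ p * fromℚᵘ q)              ∎)
  where open ℚᵘ.≤-Reasoning

fromℕ : ℕ → ℚ
fromℕ m = divℕ m 1

fromℕ-suc : ∀ m → fromℕ (suc m) ≡ 1ℚ + fromℕ m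
fromℕ-suc m = trans
  (cong (λ z → fromℚᵘ (mkℚᵘ z 0)) (sym (cong (ℤ._+_ ℤ.1ℤ) (ℤ.*-identityʳ (ℤ.+ m)))))
  (fromℚᵘ-homo-+ (mkℚᵘ ℤ.1ℤ 0) (mkℚᵘ (ℤ.+ m) 0))

divℕ-* : ∀ i j k l → divℕ (i ℕ.* j) (suc k ℕ.* suc l) ≡ divℕ i (suc k) * divℕ j (suc l)
divℕ-* i j k l = trans (cong (λ z → fromℚᵘ (mkℚᵘ z (l ℕ.+ k ℕ.* suc l))) (ℤ.pos-* i j))
                       (fromℚᵘ-homo-* (mkℚᵘ (ℤ.+ i) k) (mkℚᵘ (ℤ.+ j) l))

divℕ-self : ∀ k → divℕ (suc k) (suc k) ≡ 1ℚ
divℕ-self k =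
  fromℚᵘ-cong {mkℚᵘ (ℤ.+ suc k) k} {mkℚᵘ ℤ.1ℤ 0} (*≡* (ℤ.*-comm (ℤ.+ suc k) ℤ.1ℤ))

divℕ≡fromℕ*divℕ1 : ∀ i k → divℕ i (suc k) ≡ fromℕ i * divℕ 1 (suc k)
divℕ≡fromℕ*divℕ1 i k =
  trans (cong₂ divℕ (sym (ℕ.*-identityʳ i)) (sym (ℕ.+-identityʳ (suc k)))) (divℕ-* i 1 0 k)

fromℕ*divℕ1-inverse : ∀ k → fromℕ (suc k) * divℕ 1 (suc k) ≡ 1ℚ
fromℕ*divℕ1-inverse k = trans (sym (divℕ≡fromℕ*divℕ1 (suc k) k)) (divℕ-self k)

divℕ1-* : ∀ k l → divℕ 1 (suc k ℕ.* suc l) ≡ divℕ 1 (suc k) * divℕ 1 (suc l)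
divℕ1-* = divℕ-* 1 1

fromℕ-nonNeg : ∀ m → 0ℚ ≤ fromℕ m
fromℕ-nonNeg m = nonNegative⁻¹ _ {{normalize-nonNeg m 1}}

divℕ1-nonNeg : ∀ m → 0ℚ ≤ divℕ 1 m
divℕ1-nonNeg zero    = ≤-refl
divℕ1-nonNeg (suc k) = nonNegative⁻¹ _ {{normalize-nonNeg 1 (suc k)}}

*-nonNeg : ∀ {p q} → 0ℚ ≤ p → 0ℚ ≤ q → 0ℚ ≤ p * q
*-nonNeg {p} {q} 0≤p 0≤q =
  nonNegative⁻¹ _ {{nonNeg*nonNeg⇒nonNeg p {{nonNegative 0≤p}} q {{nonNegative 0≤q}}}}

+-nonNeg : ∀ {p q} → 0ℚ ≤ p → 0ℚ ≤ q → 0ℚ ≤ p + q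
+-nonNeg {p} {q} 0≤p 0≤q =
  nonNegative⁻¹ _ {{nonNeg+nonNeg⇒nonNeg p {{nonNegative 0≤p}} q {{nonNegative 0≤q}}}}

square-nonNeg : ∀ p → 0ℚ ≤ p * p
square-nonNeg p with ≤-total 0ℚ p
... | inj₁ 0≤p = *-nonNeg 0≤p 0≤p
... | inj₂ p≤0 = nonNegative⁻¹ _ {{nonPos*nonPos⇒nonPos p {{nonPositive p≤0}} p {{nonPositive p≤0}}}}

≤-+-nonNeg : ∀ {p q} → 0ℚ ≤ q → p ≤ q + p
≤-+-nonNeg {p} 0≤q = ≤-trans (≤-reflexive (sym (+-identityˡ p))) (+-monoˡ-≤ p 0≤q)

*-mono-≤-nonNeg : ∀ {p q r s} → 0ℚ ≤ p → 0ℚ ≤ r → p ≤ q → r ≤ s → p * r ≤ q * s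
*-mono-≤-nonNeg {q = q} {r} 0≤p 0≤r p≤q r≤s = ≤-trans
  (*-monoʳ-≤-nonNeg r {{nonNegative 0≤r}} p≤q)
  (*-monoˡ-≤-nonNeg q {{nonNegative (≤-trans 0≤p p≤q)}} r≤s)

p+p≤q+q⇒p≤q : ∀ {p q} → p + p ≤ q + q → p ≤ q
p+p≤q+q⇒p≤q p+p≤q+q = ≮⇒≥ λ q<p → <-irrefl refl (≤-<-trans p+p≤q+q (+-mono-< q<p q<p))

p*p≤q*q⇒p≤q : ∀ {p q} → 0ℚ ≤ q → p * p ≤ q * q → p ≤ q
p*p≤q*q⇒p≤q {p} {q} 0≤q p*p≤q*q = ≮⇒≥ λ q<p → <-irrefl refl (begin-strict
  p * p  ≤⟨ p*p≤q*q ⟩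
  q * q  ≤⟨ *-monoˡ-≤-nonNeg q {{nonNegative 0≤q}} (<⇒≤ q<p) ⟩
  q * p  <⟨ *-monoˡ-<-pos p {{positive (≤-<-trans 0≤q q<p)}} q<p ⟩
  p * p  ∎)
  where open ≤-Reasoning

p≤q⇒0≤q-p : ∀ {p q} → p ≤ q → 0ℚ ≤ q - p
p≤q⇒0≤q-p {p} p≤q = ≤-trans (≤-reflexive (sym (+-inverseʳ p))) (+-monoˡ-≤ (- p) p≤q)

p≤q⇒p-q≤0 : ∀ {p q} → p ≤ q → p - q ≤ 0ℚ
p≤q⇒p-q≤0 {q = q} p≤q = ≤-trans (+-monoˡ-≤ (- q) p≤q) (≤-reflexive (+-inverseʳ q))

divℕ1≤1 : ∀ k → divℕ 1 (suc k) ≤ 1ℚ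
divℕ1≤1 k = begin
  u                      ≤⟨ ≤-+-nonNeg (*-nonNeg (fromℕ-nonNeg k) (divℕ1-nonNeg (suc k))) ⟩
  fromℕ k * u + u        ≡⟨ distrib (fromℕ k) u ⟩
  (1ℚ + fromℕ k) * u     ≡⟨ cong (_* u) (fromℕ-suc k) ⟨
  fromℕ (suc k) * u      ≡⟨ fromℕ*divℕ1-inverse k ⟩
  1ℚ                     ∎
  where
  open ≤-Reasoning
  u = divℕ 1 (suc k)
  distrib : ∀ m u → m * u + u ≡ (1ℚ + m) * u
  distrib = solve-∀ ℚ-ring

-- Finite sums

∑ : {A : Set} → List A → (A → ℚ) → ℚ
∑ xs f = sumℚ (map f xs)

syntax ∑ xs (λ x → e) = ∑[ x ∈ xs ] e

module _ {A : Set} where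

  ∑-cong : ∀ (xs : List A) {f g : A → ℚ} → (∀ x → f x ≡ g x) → ∑ xs f ≡ ∑ xs g
  ∑-cong []       f≗g = refl
  ∑-cong (x ∷ xs) f≗g = cong₂ _+_ (f≗g x) (∑-cong xs f≗g)

  ∑-0 : ∀ (xs : List A) → ∑[ x ∈ xs ] 0ℚ ≡ 0ℚ
  ∑-0 []       = refl
  ∑-0 (x ∷ xs) = trans (+-identityˡ _) (∑-0 xs)

  ∑-+ : ∀ (xs : List A) (f g : A → ℚ) → ∑[ x ∈ xs ] (f x + g x) ≡ ∑ xs f + ∑ xs g
  ∑-+ []       f g = refl
  ∑-+ (x ∷ xs) f g = trans (cong (f x + g x +_) (∑-+ xs f g)) (+-interchange (f x) (g x) _ _)

  ∑-*ˡ : ∀ (xs : List A) c (f : A → ℚ) → ∑[ x ∈ xs ] (c * f x) ≡ c * ∑ xs f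
  ∑-*ˡ []       c f = sym (*-zeroʳ c)
  ∑-*ˡ (x ∷ xs) c f = trans (cong (c * f x +_) (∑-*ˡ xs c f)) (sym (*-distribˡ-+ c (f x) _))

  ∑-*ʳ : ∀ (xs : List A) c (f : A → ℚ) → ∑[ x ∈ xs ] (f x * c) ≡ ∑ xs f * c
  ∑-*ʳ xs c f = trans (∑-cong xs (λ x → *-comm (f x) c)) (trans (∑-*ˡ xs c f) (*-comm c _))

  ∑-++ : ∀ (xs ys : List A) (f : A → ℚ) → ∑ (xs ++ ys) f ≡ ∑ xs f + ∑ ys f
  ∑-++ []       ys f = sym (+-identityˡ _)
  ∑-++ (x ∷ xs) ys f = trans (cong (f x +_) (∑-++ xs ys f)) (sym (+-assoc (f x) _ _))

  ∑-nonNeg : ∀ (xs : List A) {f : A → ℚ} → (∀ x → 0ℚ ≤ f x) → 0ℚ ≤ ∑ xs f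
  ∑-nonNeg []       0≤f = ≤-refl
  ∑-nonNeg (x ∷ xs) 0≤f = +-nonNeg (0≤f x) (∑-nonNeg xs 0≤f)

  ∑-if : ∀ (xs : List A) (b : A → Bool) c →
         ∑[ x ∈ xs ] (if b x then c else 0ℚ) ≡ fromℕ (length (filterᵇ b xs)) * c
  ∑-if []       b c = sym (*-zeroˡ c)
  ∑-if (x ∷ xs) b c with b x
  ... | true  = begin
    c + ∑[ x ∈ xs ] (if b x then c else 0ℚ)   ≡⟨ cong (c +_) (∑-if xs b c) ⟩
    c + fromℕ m * c                          ≡⟨ distrib c (fromℕ m) ⟩
    (1ℚ + fromℕ m) * c                       ≡⟨ cong (_* c) (fromℕ-suc m) ⟨
    fromℕ (suc m) * c                        ∎
    where
    open ≡-Reasoning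
    m = length (filterᵇ b xs)
    distrib : ∀ c m → c + m * c ≡ (1ℚ + m) * c
    distrib = solve-∀ ℚ-ring
  ... | false = trans (+-identityˡ _) (∑-if xs b c)

  ∑-square≤square-∑ : ∀ (xs : List A) {f : A → ℚ} → (∀ x → 0ℚ ≤ f x) →
                      ∑[ x ∈ xs ] (f x * f x) ≤ ∑ xs f * ∑ xs f
  ∑-square≤square-∑ []       0≤f = ≤-reflexive (sym (*-zeroˡ 0ℚ))
  ∑-square≤square-∑ (x ∷ xs) {f} 0≤f = begin
    f x * f x + ∑[ x ∈ xs ] (f x * f x)
      ≤⟨ +-monoʳ-≤ (f x * f x) (∑-square≤square-∑ xs 0≤f) ⟩
    f x * f x + S * S
      ≤⟨ +-monoʳ-≤ (f x * f x) (≤-+-nonNeg (+-nonNeg 0≤fS 0≤fS)) ⟩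
    f x * f x + ((f x * S + f x * S) + S * S)
      ≡⟨ square-+ (f x) S ⟩
    (f x + S) * (f x + S) ∎
    where
    open ≤-Reasoning
    S = ∑ xs f
    0≤fS : 0ℚ ≤ f x * S
    0≤fS = *-nonNeg (0≤f x) (∑-nonNeg xs 0≤f)
    square-+ : ∀ a s → a * a + ((a * s + a * s) + s * s) ≡ (a + s) * (a + s)
    square-+ = solve-∀ ℚ-ring

module _ {A B : Set} where

  ∑-concatMap : ∀ (xs : List B) (g : B → List A) (f : A → ℚ) →
                ∑ (concatMap g xs) f ≡ ∑[ x ∈ xs ] ∑ (g x) f
  ∑-concatMap []       g f = refl
  ∑-concatMap (x ∷ xs) g f = trans (∑-++ (g x) _ f) (cong (∑ (g x) f +_) (∑-concatMap xs g f))

  ∑-map : ∀ (xs : List B) (h : B → A) (f : A → ℚ) → ∑ (map h xs) f ≡ ∑[ x ∈ xs ] f (h x)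
  ∑-map []       h f = refl
  ∑-map (x ∷ xs) h f = cong (f (h x) +_) (∑-map xs h f)

  ∑-comm : ∀ (xs : List A) (ys : List B) (f : A → B → ℚ) →
           ∑[ x ∈ xs ] ∑[ y ∈ ys ] f x y ≡ ∑[ y ∈ ys ] ∑[ x ∈ xs ] f x y
  ∑-comm []       ys f = sym (∑-0 ys)
  ∑-comm (x ∷ xs) ys f = trans (cong (∑ ys (f x) +_) (∑-comm xs ys f)) (sym (∑-+ ys (f x) _))

  ∑-*-∑ : ∀ (xs : List A) (ys : List B) (f : A → ℚ) (g : B → ℚ) →
          ∑ xs f * ∑ ys g ≡ ∑[ x ∈ xs ] ∑[ y ∈ ys ] (f x * g y)
  ∑-*-∑ xs ys f g = trans (sym (∑-*ʳ xs (∑ ys g) f)) (∑-cong xs (λ x → sym (∑-*ˡ ys (f x) g)))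

∑-vecsOver-suc : ∀ {A : Set} (xs : List A) k (F : Vec A (suc k) → ℚ) →
                 ∑ (vecsOver xs (suc k)) F ≡ ∑[ a ∈ xs ] ∑[ v ∈ vecsOver xs k ] F (a ∷ v)
∑-vecsOver-suc xs k F = trans (∑-concatMap xs _ F) (∑-cong xs (λ a → ∑-map (vecsOver xs k) (a ∷_) F))

module _ {A : Set} (xs : List A) (f g : A → ℚ) where

  private
    F G X : ℚ
    F = ∑[ i ∈ xs ] (f i * f i)
    G = ∑[ i ∈ xs ] (g i * g i)
    X = ∑[ i ∈ xs ] (f i * g i)

    ∑∑ : (A → A → ℚ) → ℚ
    ∑∑ h = ∑[ i ∈ xs ] ∑[ j ∈ xs ] h i j

    ∑∑-+ : ∀ h k → ∑∑ (λ i j → h i j + k i j) ≡ ∑∑ h + ∑∑ k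
    ∑∑-+ h k = trans (∑-cong xs (λ i → ∑-+ xs (h i) (k i))) (∑-+ xs _ _)

    -- Lagrange's identity, with both sides moved so that no subtraction of sums occurs.
    lagrange : ∑∑ (λ i j → (f i * g j - f j * g i) * (f i * g j - f j * g i)) + (X * X + X * X)
             ≡ F * G + F * G
    lagrange = begin
      ∑∑ D + (X * X + X * X)
        ≡⟨ cong (λ Y → ∑∑ D + (Y + Y)) (∑-*-∑ xs xs _ _) ⟩
      ∑∑ D + (∑∑ P + ∑∑ P)
        ≡⟨ trans (∑∑-+ D _) (cong (∑∑ D +_) (∑∑-+ P P)) ⟨
      ∑∑ (λ i j → D i j + (P i j + P i j))
        ≡⟨ ∑-cong xs (λ i → ∑-cong xs (λ j → pointwise (f i) (g i) (f j) (g j))) ⟩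
      ∑∑ (λ i j → (f i * f i) * (g j * g j) + (g i * g i) * (f j * f j))
        ≡⟨ ∑∑-+ _ _ ⟩
      ∑∑ (λ i j → (f i * f i) * (g j * g j)) + ∑∑ (λ i j → (g i * g i) * (f j * f j))
        ≡⟨ cong₂ _+_ (∑-*-∑ xs xs _ _) (∑-*-∑ xs xs _ _) ⟨
      F * G + G * F
        ≡⟨ cong (F * G +_) (*-comm G F) ⟩
      F * G + F * G ∎
      where
      open ≡-Reasoning
      D P : A → A → ℚ
      D i j = (f i * g j - f j * g i) * (f i * g j - f j * g i)
      P i j = (f i * g i) * (f j * g j)
      pointwise : ∀ a b c e → (a * e - c * b) * (a * e - c * b) + ((a * b) * (c * e) + (a * b) * (c * e))
                            ≡ (a * a) * (e * e) + (b * b) * (c * c)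
      pointwise = solve-∀ ℚ-ring

  cauchy-schwarz : X * X ≤ F * G
  cauchy-schwarz = p+p≤q+q⇒p≤q (≤-trans (≤-+-nonNeg 0≤D) (≤-reflexive lagrange))
    where
    0≤D = ∑-nonNeg xs (λ i → ∑-nonNeg xs (λ j → square-nonNeg (f i * g j - f j * g i)))

  cauchy-schwarz-bound : ∀ {a c} → 0ℚ ≤ a → 0ℚ ≤ c → F ≤ a * a → G ≤ c * c → X ≤ a * c
  cauchy-schwarz-bound {a} {c} 0≤a 0≤c F≤aa G≤cc = p*p≤q*q⇒p≤q (*-nonNeg 0≤a 0≤c) (begin
    X * X              ≤⟨ cauchy-schwarz ⟩
    F * G              ≤⟨ *-mono-≤-nonNeg (∑-nonNeg xs (λ i → square-nonNeg (f i)))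
                                          (∑-nonNeg xs (λ i → square-nonNeg (g i))) F≤aa G≤cc ⟩
    (a * a) * (c * c)  ≡⟨ *-interchange a a c c ⟩
    (a * c) * (a * c)  ∎)
    where open ≤-Reasoning

module _ {n : ℕ} where

  δ-refl : (i : Fin n) → δ i i ≡ 1ℚ
  δ-refl i with i ≟ᶠ i
  ... | yes _   = refl
  ... | no i≢i  = contradiction refl i≢i

  δ-≢ : {i j : Fin n} → i ≢ j → δ i j ≡ 0ℚ
  δ-≢ {i} {j} i≢j with i ≟ᶠ j
  ... | yes i≡j = contradiction i≡j i≢j
  ... | no _    = refl

  δ-sym : (i j : Fin n) → δ i j ≡ δ j i
  δ-sym i j with i ≟ᶠ j
  ... | yes refl = sym (δ-refl i)
  ... | no i≢j   = sym (δ-≢ (i≢j ∘ sym))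

  δ-*-δ : (u i j : Fin n) → δ u i * δ u j ≡ δ i j * δ u i
  δ-*-δ u i j with u ≟ᶠ i
  ... | yes refl = *-comm 1ℚ (δ u j)
  ... | no _     = trans (*-zeroˡ (δ u j)) (sym (*-zeroʳ (δ i j)))

Σᵥ-suc : ∀ {n} (f : Fin (suc n) → ℚ) → Σᵥ f ≡ f zero + Σᵥ (f ∘ suc)
Σᵥ-suc f = cong (λ xs → f zero + sumℚ xs)
                     (trans (map-tabulate suc f) (sym (map-tabulate (λ i → i) (f ∘ suc))))

∑-δ : ∀ {n} (i : Fin n) (g : Fin n → ℚ) → Σᵥ (λ j → δ i j * g j) ≡ g i
∑-δ {suc n} zero g = begin
  Σᵥ (λ j → δ zero j * g j)
    ≡⟨ Σᵥ-suc (λ j → δ zero j * g j) ⟩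
  δ {suc n} zero zero * g zero + Σᵥ (λ j → δ zero (suc j) * g (suc j))
    ≡⟨ cong₂ _+_ (cong (_* g zero) (δ-refl {suc n} zero))
                 (∑-cong (allFin n) (λ j → cong (_* g (suc j)) (δ-≢ {i = zero} {suc j} λ ()))) ⟩
  1ℚ * g zero + Σᵥ (λ j → 0ℚ * g (suc j))
    ≡⟨ cong₂ _+_ (*-identityˡ (g zero))
                 (trans (∑-cong (allFin n) (λ j → *-zeroˡ (g (suc j)))) (∑-0 (allFin n))) ⟩
  g zero + 0ℚ
    ≡⟨ +-identityʳ (g zero) ⟩
  g zero ∎
  where open ≡-Reasoning
∑-δ {suc n} (suc i) g = begin
  Σᵥ (λ j → δ (suc i) j * g j)
    ≡⟨ Σᵥ-suc (λ j → δ (suc i) j * g j) ⟩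
  δ (suc i) zero * g zero + Σᵥ (λ j → δ (suc i) (suc j) * g (suc j))
    ≡⟨ cong₂ _+_ (trans (cong (_* g zero) (δ-≢ {i = suc i} {zero} λ ())) (*-zeroˡ (g zero)))
                 (∑-cong (allFin n) (λ j → cong (_* g (suc j)) (δ-suc i j))) ⟩
  0ℚ + Σᵥ (λ j → δ i j * g (suc j))
    ≡⟨ +-identityˡ _ ⟩
  Σᵥ (λ j → δ i j * g (suc j))
    ≡⟨ ∑-δ i (g ∘ suc) ⟩
  g (suc i) ∎
  where
  open ≡-Reasoning
  δ-suc : ∀ {n} (i j : Fin n) → δ (suc i) (suc j) ≡ δ i j
  δ-suc i j with i ≟ᶠ j
  ... | yes _ = refl
  ... | no _  = refl

-- Moments of empirical distributions

_² : ∀ {n} → (Fin n → ℚ) → Fin n → ℚ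
(r ²) i = r i * r i

-- For the empirical distribution p̂ of 1/u i.i.d. samples from p, and an independent q̂ of the same
-- size from q, E[p̂(i) p̂(j)] = empiricalMoment u p i j and E[⟨p̂, q̂⟩²] = productMoment u p q.
empiricalMoment : ∀ {n} → ℚ → (Fin n → ℚ) → Fin n → Fin n → ℚ
empiricalMoment u r i j = u * (δ i j * r i) + (1ℚ - u) * (r i * r j)

productMoment : ∀ {n} → ℚ → (Fin n → ℚ) → (Fin n → ℚ) → ℚ
productMoment u p q = u * u * inner p q + u * (1ℚ - u) * (inner p (q ²) + inner q (p ²))
                    + (1ℚ - u) * (1ℚ - u) * (inner p q * inner p q)

inner-square : ∀ {n} (p q : Fin n → ℚ) →
               inner p q * inner p q ≡ Σᵥ (λ i → Σᵥ (λ j → (p i * p j) * (q i * q j)))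
inner-square {n} p q = trans (∑-*-∑ (allFin n) (allFin n) _ _)
  (∑-cong (allFin n) (λ i → ∑-cong (allFin n) (λ j → *-interchange (p i) (q i) (p j) (q j))))

∑∑-empiricalMoment : ∀ {n} u (p q : Fin n → ℚ) →
  Σᵥ (λ i → Σᵥ (λ j → empiricalMoment u p i j * empiricalMoment u q i j)) ≡ productMoment u p q
∑∑-empiricalMoment {n} u p q = begin
  Σᵥ (λ i → Σᵥ (λ j → empiricalMoment u p i j * empiricalMoment u q i j))
    ≡⟨ ∑-cong (allFin n) row ⟩
  Σᵥ (λ i → (u * u + v * v * Π) * (p i * q i) + u * v * (p i * (q ²) i) + u * v * (q i * (p ²) i))
    ≡⟨ trans (∑-+ (allFin n) _ _) (cong₂ _+_ (trans (∑-+ (allFin n) _ _)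
         (cong₂ _+_ (∑-*ˡ (allFin n) (u * u + v * v * Π) (λ i → p i * q i))
                    (∑-*ˡ (allFin n) (u * v) (λ i → p i * (q ²) i))))
         (∑-*ˡ (allFin n) (u * v) (λ i → q i * (p ²) i))) ⟩
  (u * u + v * v * Π) * Π + u * v * inner p (q ²) + u * v * inner q (p ²)
    ≡⟨ collect (u * u) (u * v) (v * v) Π (inner p (q ²)) (inner q (p ²)) ⟩
  productMoment u p q ∎
  where
  open ≡-Reasoning
  v = 1ℚ - u
  Π = inner p q
  split : ∀ u v D P Q P′ Q′ → (u * (D * P) + v * (P * P′)) * (u * (D * Q) + v * (Q * Q′))
        ≡ D * (u * u * (D * (P * Q)) + u * v * (P * (Q * Q′)) + u * v * (Q * (P * P′)))
          + v * v * (P * Q) * (P′ * Q′)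
  split = solve-∀ ℚ-ring
  diagonal : ∀ U W V P Q Π → U * (1ℚ * (P * Q)) + W * (P * (Q * Q)) + W * (Q * (P * P)) + V * (P * Q) * Π
           ≡ (U + V * Π) * (P * Q) + W * (P * (Q * Q)) + W * (Q * (P * P))
  diagonal = solve-∀ ℚ-ring
  collect : ∀ U W V Π S T → (U + V * Π) * Π + W * S + W * T ≡ U * Π + W * (S + T) + V * (Π * Π)
  collect = solve-∀ ℚ-ring
  -- After splitting off δ i j, the sum over j sifts out the diagonal term j = i.
  row : ∀ i → Σᵥ (λ j → empiricalMoment u p i j * empiricalMoment u q i j)
            ≡ (u * u + v * v * Π) * (p i * q i) + u * v * (p i * (q ²) i) + u * v * (q i * (p ²) i)
  row i = begin
    Σᵥ (λ j → empiricalMoment u p i j * empiricalMoment u q i j)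
      ≡⟨ ∑-cong (allFin n) (λ j → split u v (δ i j) (p i) (q i) (p j) (q j)) ⟩
    Σᵥ (λ j → δ i j * g j + v * v * (p i * q i) * (p j * q j))
      ≡⟨ trans (∑-+ (allFin n) _ _)
               (cong₂ _+_ (∑-δ i g) (∑-*ˡ (allFin n) (v * v * (p i * q i)) (λ j → p j * q j))) ⟩
    g i + v * v * (p i * q i) * Π
      ≡⟨ cong (λ e → u * u * (e * (p i * q i)) + u * v * (p i * (q ²) i) + u * v * (q i * (p ²) i)
                     + v * v * (p i * q i) * Π) (δ-refl i) ⟩
    u * u * (1ℚ * (p i * q i)) + u * v * (p i * (q ²) i) + u * v * (q i * (p ²) i) + v * v * (p i * q i) * Π
      ≡⟨ diagonal (u * u) (u * v) (v * v) (p i) (q i) Π ⟩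
    (u * u + v * v * Π) * (p i * q i) + u * v * (p i * (q ²) i) + u * v * (q i * (p ²) i) ∎
    where
    g : Fin n → ℚ
    g j = u * u * (δ i j * (p i * q i)) + u * v * (p i * (q i * q j)) + u * v * (q i * (p i * p j))

normSq-²-bound : ∀ {n} (r : Fin n → ℚ) {b} → 0ℚ ≤ b → normSq r ≤ b * b →
                 normSq (r ²) ≤ (b * b) * (b * b)
normSq-²-bound {n} r 0≤b ‖r‖≤b = ≤-trans
  (∑-square≤square-∑ (allFin n) (λ i → square-nonNeg (r i)))
  (*-mono-≤-nonNeg 0≤‖r‖ 0≤‖r‖ ‖r‖≤b ‖r‖≤b)
  where
  0≤‖r‖ = ∑-nonNeg (allFin n) (λ i → square-nonNeg (r i))

productMoment-bound : ∀ {n u a c} (p q : Fin n → ℚ) → 0ℚ ≤ u → u ≤ 1ℚ → 0ℚ ≤ a → 0ℚ ≤ c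
  → normSq p ≤ a * a → normSq q ≤ c * c
  → productMoment u p q - inner p q * inner p q ≤ u * u * (a * c) + u * (a * (c * c) + (a * a) * c)
productMoment-bound {n} {u} {a} {c} p q 0≤u u≤1 0≤a 0≤c ‖p‖≤a ‖q‖≤c = begin
  productMoment u p q - Π * Π
    ≡⟨ regroup (u * u) (u * v) (v * v) Π (inner p (q ²)) (inner q (p ²)) ⟩
  u * u * Π + u * v * (inner p (q ²) + inner q (p ²)) + (v * v * (Π * Π) - Π * Π)
    ≤⟨ +-mono-≤ (+-mono-≤ (*-monoˡ-≤-nonNeg (u * u) {{nonNegative (square-nonNeg u)}} Π≤ac)
                          cross≤)
                square≤0 ⟩
  u * u * (a * c) + u * B + 0ℚ
    ≡⟨ +-identityʳ _ ⟩
  u * u * (a * c) + u * B ∎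
  where
  open ≤-Reasoning
  v = 1ℚ - u
  Π = inner p q
  B = a * (c * c) + (a * a) * c
  0≤v : 0ℚ ≤ v
  0≤v = p≤q⇒0≤q-p u≤1
  v≤1 : v ≤ 1ℚ
  v≤1 = +-monoʳ-≤ 1ℚ (neg-antimono-≤ 0≤u)
  Π≤ac : Π ≤ a * c
  Π≤ac = cauchy-schwarz-bound (allFin n) p q 0≤a 0≤c ‖p‖≤a ‖q‖≤c
  pq²≤acc : inner p (q ²) ≤ a * (c * c)
  pq²≤acc = cauchy-schwarz-bound (allFin n) p (q ²) 0≤a (square-nonNeg c)
                                 ‖p‖≤a (normSq-²-bound q 0≤c ‖q‖≤c)
  qp²≤aac : inner q (p ²) ≤ (a * a) * c
  qp²≤aac = ≤-trans (cauchy-schwarz-bound (allFin n) q (p ²) 0≤c (square-nonNeg a)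
                                           ‖q‖≤c (normSq-²-bound p 0≤a ‖p‖≤a))
                    (≤-reflexive (*-comm c (a * a)))
  cross≤ : u * v * (inner p (q ²) + inner q (p ²)) ≤ u * B
  cross≤ = begin
    u * v * (inner p (q ²) + inner q (p ²))
      ≤⟨ *-monoˡ-≤-nonNeg (u * v) {{nonNegative (*-nonNeg 0≤u 0≤v)}} (+-mono-≤ pq²≤acc qp²≤aac) ⟩
    u * v * B
      ≤⟨ *-monoʳ-≤-nonNeg B {{nonNegative 0≤B}} (*-monoˡ-≤-nonNeg u {{nonNegative 0≤u}} v≤1) ⟩
    u * 1ℚ * B
      ≡⟨ cong (_* B) (*-identityʳ u) ⟩
    u * B ∎
    where
    0≤B = +-nonNeg (*-nonNeg 0≤a (square-nonNeg c)) (*-nonNeg (square-nonNeg a) 0≤c)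
  square≤0 : v * v * (Π * Π) - Π * Π ≤ 0ℚ
  square≤0 = p≤q⇒p-q≤0 (≤-trans
    (*-monoʳ-≤-nonNeg (Π * Π) {{nonNegative (square-nonNeg Π)}} (*-mono-≤-nonNeg 0≤v 0≤v v≤1 v≤1))
    (≤-reflexive (*-identityˡ (Π * Π))))
  regroup : ∀ U W V P S T → U * P + W * (S + T) + V * (P * P) - P * P
                          ≡ U * P + W * (S + T) + (V * (P * P) - P * P)
  regroup = solve-∀ ℚ-ring

-- Finite expectations and i.i.d. samples

module Weighted {X : Set} (xs : List X) (w : X → ℚ) where

  𝔼 : (X → ℚ) → ℚ
  𝔼 f = ∑[ x ∈ xs ] (w x * f x)

  𝔼-cong : ∀ {f g : X → ℚ} → (∀ x → f x ≡ g x) → 𝔼 f ≡ 𝔼 g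
  𝔼-cong f≗g = ∑-cong xs (λ x → cong (w x *_) (f≗g x))

  𝔼-+ : ∀ (f g : X → ℚ) → 𝔼 (λ x → f x + g x) ≡ 𝔼 f + 𝔼 g
  𝔼-+ f g = trans (∑-cong xs (λ x → *-distribˡ-+ (w x) (f x) (g x))) (∑-+ xs _ _)

  𝔼-*ˡ : ∀ c (f : X → ℚ) → 𝔼 (λ x → c * f x) ≡ c * 𝔼 f
  𝔼-*ˡ c f = trans (∑-cong xs (λ x → *-left-comm (w x) c (f x))) (∑-*ˡ xs c _)

  𝔼-*ʳ : ∀ c (f : X → ℚ) → 𝔼 (λ x → f x * c) ≡ 𝔼 f * c
  𝔼-*ʳ c f = trans (𝔼-cong (λ x → *-comm (f x) c)) (trans (𝔼-*ˡ c f) (*-comm c (𝔼 f)))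

  module Probability (𝔼-1 : 𝔼 (λ _ → 1ℚ) ≡ 1ℚ) where

    𝔼-const : ∀ c → 𝔼 (λ _ → c) ≡ c
    𝔼-const c = begin
      𝔼 (λ _ → c)         ≡⟨ 𝔼-cong (λ _ → *-identityʳ c) ⟨
      𝔼 (λ _ → c * 1ℚ)    ≡⟨ 𝔼-*ˡ c (λ _ → 1ℚ) ⟩
      c * 𝔼 (λ _ → 1ℚ)    ≡⟨ cong (c *_) 𝔼-1 ⟩
      c * 1ℚ              ≡⟨ *-identityʳ c ⟩
      c                   ∎
      where open ≡-Reasoning

    𝔼-const-+ : ∀ c (f : X → ℚ) → 𝔼 (λ x → c + f x) ≡ c + 𝔼 f
    𝔼-const-+ c f = trans (𝔼-+ (λ _ → c) f) (cong (_+ 𝔼 f) (𝔼-const c))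

    𝔼-product-expansion : ∀ a b (f g : X → ℚ) →
      𝔼 (λ x → (a + f x) * (b + g x)) ≡ a * b + (a * 𝔼 g + b * 𝔼 f) + 𝔼 (λ x → f x * g x)
    𝔼-product-expansion a b f g = begin
      𝔼 (λ x → (a + f x) * (b + g x))
        ≡⟨ 𝔼-cong (λ x → expand a b (f x) (g x)) ⟩
      𝔼 (λ x → a * b + ((a * g x + b * f x) + f x * g x))
        ≡⟨ 𝔼-const-+ (a * b) _ ⟩
      a * b + 𝔼 (λ x → (a * g x + b * f x) + f x * g x)
        ≡⟨ cong (a * b +_) (trans (𝔼-+ _ _) (cong (_+ 𝔼 (λ x → f x * g x))
                             (trans (𝔼-+ _ _) (cong₂ _+_ (𝔼-*ˡ a g) (𝔼-*ˡ b f))))) ⟩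
      a * b + ((a * 𝔼 g + b * 𝔼 f) + 𝔼 (λ x → f x * g x))
        ≡⟨ +-assoc (a * b) _ _ ⟨
      a * b + (a * 𝔼 g + b * 𝔼 f) + 𝔼 (λ x → f x * g x) ∎
      where
      open ≡-Reasoning
      expand : ∀ a b f g → (a + f) * (b + g) ≡ a * b + ((a * g + b * f) + f * g)
      expand = solve-∀ ℚ-ring

module Product {X Y : Set} (xs : List X) (v : X → ℚ) (ys : List Y) (w : Y → ℚ) where

  𝔼⊗ : (X → Y → ℚ) → ℚ
  𝔼⊗ F = ∑[ a ∈ xs ] ∑[ b ∈ ys ] (v a * w b * F a b)

  𝔼⊗-cong : ∀ {F G : X → Y → ℚ} → (∀ a b → F a b ≡ G a b) → 𝔼⊗ F ≡ 𝔼⊗ G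
  𝔼⊗-cong F≗G = ∑-cong xs (λ a → ∑-cong ys (λ b → cong (v a * w b *_) (F≗G a b)))

  𝔼⊗-∑ : ∀ {I : Set} (is : List I) (H : I → X → Y → ℚ) →
         𝔼⊗ (λ a b → ∑[ i ∈ is ] H i a b) ≡ ∑[ i ∈ is ] 𝔼⊗ (H i)
  𝔼⊗-∑ is H = trans
    (∑-cong xs (λ a → trans (∑-cong ys (λ b → sym (∑-*ˡ is (v a * w b) (λ i → H i a b))))
                            (∑-comm ys is _)))
    (∑-comm xs is _)

  𝔼⊗-independent : ∀ (F : X → ℚ) (G : Y → ℚ) →
                   𝔼⊗ (λ a b → F a * G b) ≡ Weighted.𝔼 xs v F * Weighted.𝔼 ys w G
  𝔼⊗-independent F G = trans
    (∑-cong xs (λ a → ∑-cong ys (λ b → *-interchange (v a) (w b) (F a) (G b))))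
    (sym (∑-*-∑ xs ys _ _))

sampleSum : {X : Set} → (X → ℚ) → ∀ {m} → Vec X m → ℚ
sampleSum f v = ∑ (vecToList v) f

sampleMean : {X : Set} → (X → ℚ) → ∀ {m} → Vec X m → ℚ
sampleMean f {m} v = divℕ 1 m * sampleSum f v

module Sample {X : Set} (xs : List X) (w : X → ℚ) where

  open Weighted xs w

  sampleWeight : ∀ {m} → Vec X m → ℚ
  sampleWeight v = prodℚ (map w (vecToList v))

  𝔼ⁿ : (m : ℕ) → (Vec X m → ℚ) → ℚ
  𝔼ⁿ m = Weighted.𝔼 (vecsOver xs m) sampleWeight

  module Wⁿ (m : ℕ) = Weighted (vecsOver xs m) sampleWeight

  𝔼ⁿ-suc : ∀ m (F : Vec X (suc m) → ℚ) →
           𝔼ⁿ (suc m) F ≡ 𝔼 (λ a → 𝔼ⁿ m (λ v → F (a ∷ v)))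
  𝔼ⁿ-suc m F = trans (∑-vecsOver-suc xs m _) (∑-cong xs (λ a → trans
    (∑-cong (vecsOver xs m) (λ v → *-assoc (w a) (sampleWeight v) (F (a ∷ v))))
    (∑-*ˡ (vecsOver xs m) (w a) _)))

  module IID (𝔼-1 : 𝔼 (λ _ → 1ℚ) ≡ 1ℚ) where

    open Probability 𝔼-1

    𝔼ⁿ-1 : ∀ m → 𝔼ⁿ m (λ _ → 1ℚ) ≡ 1ℚ
    𝔼ⁿ-1 zero    = refl
    𝔼ⁿ-1 (suc m) = trans (𝔼ⁿ-suc m _) (trans (𝔼-cong (λ _ → 𝔼ⁿ-1 m)) 𝔼-1)

    module Pⁿ (m : ℕ) = Wⁿ.Probability m (𝔼ⁿ-1 m)

    𝔼ⁿ-sampleSum : ∀ m (f : X → ℚ) → 𝔼ⁿ m (sampleSum f) ≡ fromℕ m * 𝔼 f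
    𝔼ⁿ-sampleSum zero    f = sym (*-zeroˡ (𝔼 f))
    𝔼ⁿ-sampleSum (suc m) f = begin
      𝔼ⁿ (suc m) (sampleSum f)
        ≡⟨ 𝔼ⁿ-suc m _ ⟩
      𝔼 (λ a → 𝔼ⁿ m (λ v → f a + sampleSum f v))
        ≡⟨ 𝔼-cong (λ a → trans (Pⁿ.𝔼-const-+ m (f a) _) (cong (f a +_) (𝔼ⁿ-sampleSum m f))) ⟩
      𝔼 (λ a → f a + fromℕ m * 𝔼 f)
        ≡⟨ trans (𝔼-+ f _) (cong (𝔼 f +_) (𝔼-const _)) ⟩
      𝔼 f + fromℕ m * 𝔼 f
        ≡⟨ distrib (𝔼 f) (fromℕ m) ⟩
      (1ℚ + fromℕ m) * 𝔼 f
        ≡⟨ cong (_* 𝔼 f) (fromℕ-suc m) ⟨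
      fromℕ (suc m) * 𝔼 f ∎
      where
      open ≡-Reasoning
      distrib : ∀ e m → e + m * e ≡ (1ℚ + m) * e
      distrib = solve-∀ ℚ-ring

    𝔼ⁿ-sampleSum-* : ∀ m (f g : X → ℚ) → 𝔼ⁿ m (λ v → sampleSum f v * sampleSum g v)
               ≡ fromℕ m * 𝔼 (λ x → f x * g x) + (fromℕ m * fromℕ m - fromℕ m) * (𝔼 f * 𝔼 g)
    𝔼ⁿ-sampleSum-* zero    f g = vanish (𝔼 (λ x → f x * g x)) (𝔼 f * 𝔼 g)
      where
      vanish : ∀ a b → 0ℚ ≡ 0ℚ * a + (0ℚ * 0ℚ - 0ℚ) * b
      vanish = solve-∀ ℚ-ring
    𝔼ⁿ-sampleSum-* (suc m) f g = begin
      𝔼ⁿ (suc m) (λ v → sampleSum f v * sampleSum g v)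
        ≡⟨ 𝔼ⁿ-suc m _ ⟩
      𝔼 (λ a → 𝔼ⁿ m (λ v → (f a + sampleSum f v) * (g a + sampleSum g v)))
        ≡⟨ 𝔼-cong (λ a → Pⁿ.𝔼-product-expansion m (f a) (g a) (sampleSum f) (sampleSum g)) ⟩
      𝔼 (λ a → f a * g a + (f a * 𝔼ⁿ m (sampleSum g) + g a * 𝔼ⁿ m (sampleSum f)) + K)
        ≡⟨ 𝔼-cong (λ a → cong₂ (λ T U → f a * g a + (f a * T + g a * U) + K)
                                (𝔼ⁿ-sampleSum m g) (𝔼ⁿ-sampleSum m f)) ⟩
      𝔼 (λ a → f a * g a + (f a * (M * 𝔼 g) + g a * (M * 𝔼 f)) + K)
        ≡⟨ trans (𝔼-+ _ _) (cong₂ _+_ (trans (𝔼-+ _ _) (cong (𝔼 fg +_)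
                 (trans (𝔼-+ _ _) (cong₂ _+_ (𝔼-*ʳ _ f) (𝔼-*ʳ _ g))))) (𝔼-const K)) ⟩
      𝔼 fg + (𝔼 f * (M * 𝔼 g) + 𝔼 g * (M * 𝔼 f)) + K
        ≡⟨ cong (𝔼 fg + (𝔼 f * (M * 𝔼 g) + 𝔼 g * (M * 𝔼 f)) +_) (𝔼ⁿ-sampleSum-* m f g) ⟩
      𝔼 fg + (𝔼 f * (M * 𝔼 g) + 𝔼 g * (M * 𝔼 f)) + (M * 𝔼 fg + (M * M - M) * (𝔼 f * 𝔼 g))
        ≡⟨ step M (𝔼 fg) (𝔼 f) (𝔼 g) ⟩
      (1ℚ + M) * 𝔼 fg + ((1ℚ + M) * (1ℚ + M) - (1ℚ + M)) * (𝔼 f * 𝔼 g)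
        ≡⟨ cong (λ N → N * 𝔼 fg + (N * N - N) * (𝔼 f * 𝔼 g)) (fromℕ-suc m) ⟨
      fromℕ (suc m) * 𝔼 fg + (fromℕ (suc m) * fromℕ (suc m) - fromℕ (suc m)) * (𝔼 f * 𝔼 g) ∎
      where
      open ≡-Reasoning
      M = fromℕ m
      fg = λ x → f x * g x
      K = 𝔼ⁿ m (λ v → sampleSum f v * sampleSum g v)
      step : ∀ m e a b → e + (a * (m * b) + b * (m * a)) + (m * e + (m * m - m) * (a * b))
                       ≡ (1ℚ + m) * e + ((1ℚ + m) * (1ℚ + m) - (1ℚ + m)) * (a * b)
      step = solve-∀ ℚ-ring

    module _ (k : ℕ) where

      private
        u M : ℚ
        u = divℕ 1 (suc k)
        M = fromℕ (suc k)

      𝔼ⁿ-sampleMean : ∀ (f : X → ℚ) → 𝔼ⁿ (suc k) (sampleMean f) ≡ 𝔼 f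
      𝔼ⁿ-sampleMean f = begin
        𝔼ⁿ (suc k) (sampleMean f)     ≡⟨ Wⁿ.𝔼-*ˡ (suc k) u (sampleSum f) ⟩
        u * 𝔼ⁿ (suc k) (sampleSum f)  ≡⟨ cong (u *_) (𝔼ⁿ-sampleSum (suc k) f) ⟩
        u * (M * 𝔼 f)                 ≡⟨ *-assoc u M (𝔼 f) ⟨
        (u * M) * 𝔼 f                 ≡⟨ cong (_* 𝔼 f) (trans (*-comm u M) (fromℕ*divℕ1-inverse k)) ⟩
        1ℚ * 𝔼 f                      ≡⟨ *-identityˡ (𝔼 f) ⟩
        𝔼 f                           ∎
        where open ≡-Reasoning

      𝔼ⁿ-sampleMean-* : ∀ (f g : X → ℚ) → 𝔼ⁿ (suc k) (λ v → sampleMean f v * sampleMean g v)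
                ≡ u * 𝔼 (λ x → f x * g x) + (1ℚ - u) * (𝔼 f * 𝔼 g)
      𝔼ⁿ-sampleMean-* f g = begin
        𝔼ⁿ (suc k) (λ v → sampleMean f v * sampleMean g v)
          ≡⟨ Wⁿ.𝔼-cong (suc k) (λ v → *-interchange u (sampleSum f v) u (sampleSum g v)) ⟩
        𝔼ⁿ (suc k) (λ v → (u * u) * (sampleSum f v * sampleSum g v))
          ≡⟨ trans (Wⁿ.𝔼-*ˡ (suc k) (u * u) _) (cong ((u * u) *_) (𝔼ⁿ-sampleSum-* (suc k) f g)) ⟩
        (u * u) * (M * 𝔼 fg + (M * M - M) * (𝔼 f * 𝔼 g))
          ≡⟨ regroup u M (𝔼 fg) (𝔼 f * 𝔼 g) ⟩
        G (M * u)
          ≡⟨ cong G (fromℕ*divℕ1-inverse k) ⟩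
        G 1ℚ
          ≡⟨ simplify u (𝔼 fg) (𝔼 f * 𝔼 g) ⟩
        u * 𝔼 fg + (1ℚ - u) * (𝔼 f * 𝔼 g) ∎
        where
        open ≡-Reasoning
        fg = λ x → f x * g x
        G : ℚ → ℚ
        G e = (e * u) * 𝔼 fg + (e * e - e * u) * (𝔼 f * 𝔼 g)
        regroup : ∀ u M a b → (u * u) * (M * a + (M * M - M) * b)
                            ≡ ((M * u) * u) * a + ((M * u) * (M * u) - (M * u) * u) * b
        regroup = solve-∀ ℚ-ring
        simplify : ∀ u a b → (1ℚ * u) * a + (1ℚ * 1ℚ - 1ℚ * u) * b ≡ u * a + (1ℚ - u) * b
        simplify = solve-∀ ℚ-ring

-- Random walks and the batch estimator

module RandomWalk {n : ℕ} (A : Adjacency n) (d : ℕ) where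

  𝐌 : Fin n → Fin n → ℚ
  𝐌 = walkMat A d

  ColumnStochastic : Set
  ColumnStochastic = ∀ s → Σᵥ (λ v → 𝐌 v s) ≡ 1ℚ

  walkMat-columnStochastic : (∀ u v → A u v ≡ A v u) → (∀ u → degree A u ≡ d) → 1 ℕ.≤ d →
                             ColumnStochastic
  walkMat-columnStochastic A-sym regular (ℕ.s≤s {n = k} _) s = begin
    Σᵥ (λ v → 𝐌 v s)
      ≡⟨ ∑-+ (allFin n) _ _ ⟩
    Σᵥ (λ v → half * δ v s) + Σᵥ (λ v → if A v s then c else 0ℚ)
      ≡⟨ cong₂ _+_ (∑-*ˡ (allFin n) half _)
                   (∑-cong (allFin n) (λ v → cong (if_then c else 0ℚ) (A-sym v s))) ⟩
    half * Σᵥ (λ v → δ v s) + Σᵥ (λ v → if A s v then c else 0ℚ)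
      ≡⟨ cong₂ _+_ (cong (half *_) δ-column)
                   (trans (∑-if (allFin n) (A s) c) (cong (λ m → fromℕ m * c) (regular s))) ⟩
    half * 1ℚ + fromℕ d * c
      ≡⟨ cong (half * 1ℚ +_) d*c≡half ⟩
    half * 1ℚ + 1ℚ * half
      ≡⟨⟩
    1ℚ ∎
    where
    open ≡-Reasoning
    half c : ℚ
    half = divℕ 1 2
    c    = divℕ 1 (2 ℕ.* d)
    δ-column : Σᵥ (λ v → δ v s) ≡ 1ℚ
    δ-column = trans (∑-cong (allFin n) (λ v → trans (δ-sym v s) (sym (*-identityʳ (δ s v)))))
                     (∑-δ s (λ _ → 1ℚ))
    d*c≡half : fromℕ d * c ≡ 1ℚ * half
    d*c≡half = begin
      fromℕ d * c                 ≡⟨ divℕ≡fromℕ*divℕ1 d _ ⟨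
      divℕ d (2 ℕ.* d)            ≡⟨ cong₂ divℕ (ℕ.*-identityʳ d) (ℕ.*-comm d 2) ⟨
      divℕ (d ℕ.* 1) (d ℕ.* 2)    ≡⟨ divℕ-* d 1 k 1 ⟩
      divℕ d d * half             ≡⟨ cong (_* half) (divℕ-self k) ⟩
      1ℚ * half                   ∎

  Mpow1-suc-first : ∀ t s i → Mpow1 A d (suc t) s i ≡ Σᵥ (λ v → 𝐌 v s * Mpow1 A d t v i)
  Mpow1-suc-first zero s i = begin
    Σᵥ (λ j → 𝐌 i j * δ s j)   ≡⟨ ∑-cong (allFin n) (λ j → *-comm (𝐌 i j) (δ s j)) ⟩
    Σᵥ (λ j → δ s j * 𝐌 i j)   ≡⟨ ∑-δ s (𝐌 i) ⟩
    𝐌 i s                      ≡⟨ ∑-δ i (λ v → 𝐌 v s) ⟨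
    Σᵥ (λ v → δ i v * 𝐌 v s)   ≡⟨ ∑-cong (allFin n) (λ v → trans (*-comm (δ i v) (𝐌 v s))
                                                               (cong (𝐌 v s *_) (δ-sym i v))) ⟩
    Σᵥ (λ v → 𝐌 v s * δ v i)   ∎
    where open ≡-Reasoning
  Mpow1-suc-first (suc t) s i = begin
    Σᵥ (λ j → 𝐌 i j * Mpow1 A d (suc t) s j)
      ≡⟨ ∑-cong (allFin n) (λ j → cong (𝐌 i j *_) (Mpow1-suc-first t s j)) ⟩
    Σᵥ (λ j → 𝐌 i j * Σᵥ (λ v → 𝐌 v s * Mpow1 A d t v j))
      ≡⟨ ∑-cong (allFin n) (λ j → trans (sym (∑-*ˡ (allFin n) (𝐌 i j) _))
                                         (∑-cong (allFin n) (λ v → *-left-comm (𝐌 i j) (𝐌 v s) _))) ⟩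
    Σᵥ (λ j → Σᵥ (λ v → 𝐌 v s * (𝐌 i j * Mpow1 A d t v j)))
      ≡⟨ ∑-comm (allFin n) (allFin n) _ ⟩
    Σᵥ (λ v → Σᵥ (λ j → 𝐌 v s * (𝐌 i j * Mpow1 A d t v j)))
      ≡⟨ ∑-cong (allFin n) (λ v → ∑-*ˡ (allFin n) (𝐌 v s) _) ⟩
    Σᵥ (λ v → 𝐌 v s * Mpow1 A d (suc t) v i) ∎
    where open ≡-Reasoning

  𝔼walk : (t : ℕ) → Fin n → (Walk n t → ℚ) → ℚ
  𝔼walk t s = Weighted.𝔼 (allWalks n t) (walkProb A d s)

  𝔼walk-suc : ∀ t s (g : Walk n (suc t) → ℚ) →
              𝔼walk (suc t) s g ≡ Σᵥ (λ v → 𝐌 v s * 𝔼walk t v (λ w → g (v ∷ w)))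
  𝔼walk-suc t s g = trans (∑-vecsOver-suc (allFin n) t _) (∑-cong (allFin n) (λ v → trans
    (∑-cong (allWalks n t) (λ w → *-assoc (𝐌 v s) (walkProb A d v w) (g (v ∷ w))))
    (∑-*ˡ (allWalks n t) (𝐌 v s) _)))

  𝔼walk-endpoint : ∀ t s i → 𝔼walk t s (λ w → δ (endpoint s w) i) ≡ Mpow1 A d t s i
  𝔼walk-endpoint zero    s i = trans (+-identityʳ _) (*-identityˡ (δ s i))
  𝔼walk-endpoint (suc t) s i = begin
    𝔼walk (suc t) s (λ w → δ (endpoint s w) i)
      ≡⟨ 𝔼walk-suc t s _ ⟩
    Σᵥ (λ v → 𝐌 v s * 𝔼walk t v (λ w → δ (endpoint v w) i))
      ≡⟨ ∑-cong (allFin n) (λ v → cong (𝐌 v s *_) (𝔼walk-endpoint t v i)) ⟩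
    Σᵥ (λ v → 𝐌 v s * Mpow1 A d t v i)
      ≡⟨ Mpow1-suc-first t s i ⟨
    Mpow1 A d (suc t) s i ∎
    where open ≡-Reasoning

  𝔼walk-1 : ColumnStochastic → ∀ t s → 𝔼walk t s (λ _ → 1ℚ) ≡ 1ℚ
  𝔼walk-1 stochastic zero    s = refl
  𝔼walk-1 stochastic (suc t) s = begin
    𝔼walk (suc t) s (λ _ → 1ℚ)
      ≡⟨ 𝔼walk-suc t s _ ⟩
    Σᵥ (λ v → 𝐌 v s * 𝔼walk t v (λ _ → 1ℚ))
      ≡⟨ ∑-cong (allFin n) (λ v → trans (cong (𝐌 v s *_) (𝔼walk-1 stochastic t v)) (*-identityʳ _)) ⟩
    Σᵥ (λ v → 𝐌 v s)
      ≡⟨ stochastic s ⟩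
    1ℚ ∎
    where open ≡-Reasoning

module Estimator {n : ℕ} (A : Adjacency n) (d : ℕ) (stochastic : RandomWalk.ColumnStochastic A d)
  (t k : ℕ) (x y : Fin n) where

  open RandomWalk A d

  p : Fin n → Fin n → ℚ
  p s = Mpow1 A d t s

  u : ℚ
  u = divℕ 1 (suc k)

  hit : Fin n → Fin n → Walk n t → ℚ
  hit s i w = δ (endpoint s w) i

  module WalksFrom (s : Fin n) = Sample (allWalks n t) (walkProb A d s)
  module IIDWalksFrom (s : Fin n) = WalksFrom.IID s (𝔼walk-1 stochastic t s)

  𝔼batch : Fin n → (Batch n t (suc k) → ℚ) → ℚ
  𝔼batch s = WalksFrom.𝔼ⁿ s (suc k)

  pHat-sampleMean : ∀ s (ws : Batch n t (suc k)) i → pHat s ws i ≡ sampleMean (hit s i) ws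
  pHat-sampleMean s ws i = begin
    divℕ count (suc k)           ≡⟨ divℕ≡fromℕ*divℕ1 count k ⟩
    fromℕ count * u              ≡⟨ *-comm (fromℕ count) u ⟩
    u * fromℕ count              ≡⟨ cong (u *_) (trans (∑-if (vecToList ws) _ 1ℚ) (*-identityʳ _)) ⟨
    sampleMean (hit s i) ws      ∎
    where
    open ≡-Reasoning
    count = length (filterᵇ (λ w → ⌊ endpoint s w ≟ᶠ i ⌋) (vecToList ws))

  𝔼-pHat : ∀ s i → 𝔼batch s (λ ws → pHat s ws i) ≡ p s i
  𝔼-pHat s i = begin
    𝔼batch s (λ ws → pHat s ws i)   ≡⟨ WalksFrom.Wⁿ.𝔼-cong s (suc k) (λ ws → pHat-sampleMean s ws i) ⟩
    𝔼batch s (sampleMean (hit s i)) ≡⟨ IIDWalksFrom.𝔼ⁿ-sampleMean s k (hit s i) ⟩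
    𝔼walk t s (hit s i)             ≡⟨ 𝔼walk-endpoint t s i ⟩
    p s i                           ∎
    where open ≡-Reasoning

  𝔼-pHat-* : ∀ s i j → 𝔼batch s (λ ws → pHat s ws i * pHat s ws j) ≡ empiricalMoment u (p s) i j
  𝔼-pHat-* s i j = begin
    𝔼batch s (λ ws → pHat s ws i * pHat s ws j)
      ≡⟨ WalksFrom.Wⁿ.𝔼-cong s (suc k) (λ ws →
           cong₂ _*_ (pHat-sampleMean s ws i) (pHat-sampleMean s ws j)) ⟩
    𝔼batch s (λ ws → sampleMean (hit s i) ws * sampleMean (hit s j) ws)
      ≡⟨ IIDWalksFrom.𝔼ⁿ-sampleMean-* s k (hit s i) (hit s j) ⟩
    u * 𝔼walk t s (λ w → hit s i w * hit s j w)
      + (1ℚ - u) * (𝔼walk t s (hit s i) * 𝔼walk t s (hit s j))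
      ≡⟨ cong₂ (λ a b → u * a + (1ℚ - u) * b) same-endpoint
               (cong₂ _*_ (𝔼walk-endpoint t s i) (𝔼walk-endpoint t s j)) ⟩
    empiricalMoment u (p s) i j ∎
    where
    open ≡-Reasoning
    open Weighted (allWalks n t) (walkProb A d s) using (𝔼-cong; 𝔼-*ˡ)
    same-endpoint : 𝔼walk t s (λ w → hit s i w * hit s j w) ≡ δ i j * p s i
    same-endpoint = trans (𝔼-cong (λ w → δ-*-δ (endpoint s w) i j))
                          (trans (𝔼-*ˡ (δ i j) (hit s i)) (cong (δ i j *_) (𝔼walk-endpoint t s i)))

  open Product (allBatches n t (suc k)) (batchProb A d x) (allBatches n t (suc k)) (batchProb A d y)

  Expect-Zb : Expect A d t (suc k) x y (Zb x y) ≡ inner (p x) (p y)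
  Expect-Zb = trans (𝔼⊗-∑ (allFin n) _) (∑-cong (allFin n) (λ i →
    trans (𝔼⊗-independent _ _) (cong₂ _*_ (𝔼-pHat x i) (𝔼-pHat y i))))

  Expect-Zb² : Expect A d t (suc k) x y (λ a b → Zb x y a b * Zb x y a b) ≡ productMoment u (p x) (p y)
  Expect-Zb² = begin
    𝔼⊗ (λ a b → Zb x y a b * Zb x y a b)
      ≡⟨ 𝔼⊗-cong (λ a b → inner-square (pHat x a) (pHat y b)) ⟩
    𝔼⊗ (λ a b → Σᵥ (λ i → Σᵥ (λ j → (pHat x a i * pHat x a j) * (pHat y b i * pHat y b j))))
      ≡⟨ trans (𝔼⊗-∑ (allFin n) _) (∑-cong (allFin n) (λ i → 𝔼⊗-∑ (allFin n) _)) ⟩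
    Σᵥ (λ i → Σᵥ (λ j → 𝔼⊗ (λ a b → (pHat x a i * pHat x a j) * (pHat y b i * pHat y b j))))
      ≡⟨ ∑-cong (allFin n) (λ i → ∑-cong (allFin n) (λ j →
           trans (𝔼⊗-independent _ _) (cong₂ _*_ (𝔼-pHat-* x i j) (𝔼-pHat-* y i j)))) ⟩
    Σᵥ (λ i → Σᵥ (λ j → empiricalMoment u (p x) i j * empiricalMoment u (p y) i j))
      ≡⟨ ∑∑-empiricalMoment u (p x) (p y) ⟩
    productMoment u (p x) (p y) ∎
    where open ≡-Reasoning

  Var-Zb : Var A d t (suc k) x y (Zb x y)
         ≡ productMoment u (p x) (p y) - inner (p x) (p y) * inner (p x) (p y)
  Var-Zb = cong₂ (λ E₂ E₁ → E₂ - E₁ * E₁) Expect-Zb² Expect-Zb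

lemma1 : (n d : ℕ) (A : Adjacency n)
    → (∀ u v → A u v ≡ A v u) → (∀ u → A u u ≡ false) → (∀ u → degree A u ≡ d) → 1 ℕ.≤ d
    → (R t M : ℕ) → 1 ℕ.≤ M → M ℕ.≤ R
    → (x y : Fin n) → (b : ℕ) → 1 ℕ.≤ b → b ℕ.* M ℕ.≤ R
    → (Expect A d t M x y (Zb x y) ≡ inner (Mpow1 A d t x) (Mpow1 A d t y))
      × (∀ (a c : ℚ) → 0ℚ ≤ a → 0ℚ ≤ c
           → normSq (Mpow1 A d t x) ≤ a * a → normSq (Mpow1 A d t y) ≤ c * c
           → Var A d t M x y (Zb x y)
               ≤ divℕ 1 (M ℕ.* M) * (a * c) + divℕ 1 M * (a * (c * c) + (a * a) * c))
-- R, the batch index b and the absence of loops play no role: all batches are identically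
-- distributed, and a loop at s adds to both degree A s and column s of walkMat, leaving its sum 1.
lemma1 _ d A A-sym _ regular d≥1 _ t (suc k) _ _ x y _ _ _ = Expect-Zb , variance-bound
  where
  open Estimator A d (RandomWalk.walkMat-columnStochastic A d A-sym regular d≥1) t k x y
  variance-bound : ∀ a c → 0ℚ ≤ a → 0ℚ ≤ c → normSq (p x) ≤ a * a → normSq (p y) ≤ c * c
    → Var A d t (suc k) x y (Zb x y)
      ≤ divℕ 1 (suc k ℕ.* suc k) * (a * c) + u * (a * (c * c) + (a * a) * c)
  variance-bound a c 0≤a 0≤c ‖px‖≤a ‖py‖≤c = begin
    Var A d t (suc k) x y (Zb x y)
      ≡⟨ Var-Zb ⟩
    productMoment u (p x) (p y) - inner (p x) (p y) * inner (p x) (p y)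
      ≤⟨ productMoment-bound (p x) (p y) (divℕ1-nonNeg (suc k)) (divℕ1≤1 k) 0≤a 0≤c ‖px‖≤a ‖py‖≤c ⟩
    u * u * (a * c) + u * (a * (c * c) + (a * a) * c)
      ≡⟨ cong (λ e → e * (a * c) + u * (a * (c * c) + (a * a) * c)) (divℕ1-* k k) ⟨
    divℕ 1 (suc k ℕ.* suc k) * (a * c) + u * (a * (c * c) + (a * a) * c) ∎
    where open ≤-Reasoning
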